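{- Let $J$ be an IMV-algebra. (i) For all $x\in J$ the following are equivalent: $\Delta x=\nabla x$; $x=\nabla x$; $x=\Delta x$; $x=\Delta y$ for some $y\in J$; $x=\nabla z$ for some $z\in J$. (ii) The center $C(J)$ is closed under the operations $\neg,\oplus,\odot$ of $J$ and contains $0$ and $1$; the resulting subreduct $\mathcal C(J)=(C(J),0,1,\neg,\oplus,\odot)$ is an MV-algebra. (iii) For any IMV-algebra $K$ and homomorphism $\theta\colon J\to K$, the restriction of $\theta$ to $C(J)$ is a homomorphism of $\mathcal C(J)$ into $\mathcal C(K)$. (iv) The map $\gamma_J\colon J\to\mathcal I(\mathcal C(J))$ defined by $\gamma_J(x)=[\Delta x,\nabla x]$ is well defined and one-one.
   Context: An IMV-algebra is an algebra $J=(J,0,1,\iota,\neg,\Delta,\nabla,\oplus,\odot)$ of type $(0,0,0,1,1,1,2,2)$ satisfying the equations: $x\oplus(y\oplus z)=(x\oplus y)\oplus z$; $x\oplus y=y\oplus x$; $x\oplus 0=x$; $x\oplus\neg 0=\neg 0$; $\neg\neg x=x$; $\neg(\neg\Delta x\oplus\Delta y)\oplus\Delta y=\neg(\neg\Delta y\oplus\Delta x)\oplus\Delta x$; $x\odot y=\neg(\neg x\oplus\neg y)$; $1=\neg 0$; $\nabla x=\neg\Delta\neg x$; $\neg\iota=\iota$; $\Delta 0=0$; $\Delta 1=1$; $\Delta\iota=0$; $\Delta\Delta x=\Delta x$; $\Delta\nabla x=\nabla x$; $\Delta(x\oplus y)=\Delta x\oplus\Delta y$; $\Delta(x\odot y)=\Delta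 x\odot\Delta y$; $\Delta x\odot\neg\nabla x=0$; $\Delta x\oplus(\iota\odot\nabla x\odot\neg\Delta x)=x$. The center of $J$ is $C(J)=\{x\in J\mid\Delta x=\nabla x\}$. For an MV-algebra $A$ with natural order $\leq$, $\mathcal I(A)$ is the set of intervals $[\alpha,\beta]=\{\xi\mid\alpha\leq\xi\leq\beta\}$ ($\alpha\leq\beta$) equipped with $0=[0,0]$, $1=[1,1]$, $\iota=A$, pointwise $\neg$, Minkowski $\oplus$ and pointwise $\odot$ (i.e. $x\oplus y=\{\alpha\oplus\beta\mid\alpha\in x,\beta\in y\}$, similarly for $\odot$; these are intervals), $\Delta[\alpha,\beta]=[\alpha,\alpha]$, $\nabla[\alpha,\beta]=[\beta,\beta]$. -}

module Defs where

open import Level using (Level; _⊔_) renaming (suc to lsuc)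
open import Relation.Binary.PropositionalEquality using (_≡_)
open import Data.Product using (_×_)
open import Function.Bundles using (_⇔_)

record IMVAlgebra (a : Level) : Set (lsuc a) where
  field
    Carrier : Set a
    𝟘 𝟙 ι   : Carrier
    ¬_ Δ ∇  : Carrier → Carrier
    _⊕_ _⊙_ : Carrier → Carrier → Carrier
  infixl 6 _⊕_
  infixl 7 _⊙_
  infix 8 ¬_
  field
    ⊕-assoc  : ∀ x y z → x ⊕ (y ⊕ z) ≡ (x ⊕ y) ⊕ z
    ⊕-comm   : ∀ x y → x ⊕ y ≡ y ⊕ x
    ⊕-idʳ    : ∀ x → x ⊕ 𝟘 ≡ x
    ⊕-absorb : ∀ x → x ⊕ ¬ 𝟘 ≡ ¬ 𝟘
    ¬¬       : ∀ x → ¬ (¬ x) ≡ x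
    Δ-luk    : ∀ x y → ¬ (¬ Δ x ⊕ Δ y) ⊕ Δ y ≡ ¬ (¬ Δ y ⊕ Δ x) ⊕ Δ x
    ⊙-def    : ∀ x y → x ⊙ y ≡ ¬ (¬ x ⊕ ¬ y)
    𝟙-def    : 𝟙 ≡ ¬ 𝟘
    ∇-def    : ∀ x → ∇ x ≡ ¬ Δ (¬ x)
    ¬ι       : ¬ ι ≡ ι
    Δ𝟘       : Δ 𝟘 ≡ 𝟘
    Δ𝟙       : Δ 𝟙 ≡ 𝟙
    Δι       : Δ ι ≡ 𝟘
    ΔΔ       : ∀ x → Δ (Δ x) ≡ Δ x
    Δ∇       : ∀ x → Δ (∇ x) ≡ ∇ x
    Δ-⊕      : ∀ x y → Δ (x ⊕ y) ≡ Δ x ⊕ Δ y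
    Δ-⊙      : ∀ x y → Δ (x ⊙ y) ≡ Δ x ⊙ Δ y
    Δ⊙¬∇     : ∀ x → Δ x ⊙ ¬ ∇ x ≡ 𝟘
    decomp   : ∀ x → Δ x ⊕ (ι ⊙ ∇ x ⊙ ¬ Δ x) ≡ x

  Center : Carrier → Set a
  Center x = Δ x ≡ ∇ x

  _≤C_ : Carrier → Carrier → Set a
  α ≤C β = ¬ α ⊕ β ≡ 𝟙

  -- membership in the interval [α, β] of I(𝒞(J)), as a subset of C(J)
  InInterval : Carrier → Carrier → Carrier → Set a
  InInterval α β ξ = Center ξ × α ≤C ξ × ξ ≤C β

  SameInterval : Carrier → Carrier → Carrier → Carrier → Set a
  SameInterval α β α' β' = ∀ ξ → InInterval α β ξ ⇔ InInterval α' β' ξ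

open IMVAlgebra

record IsMVSubreduct {a p : Level} {A : Set a} (P : A → Set p)
       (z o : A) (neg : A → A) (plus times : A → A → A) : Set (a ⊔ p) where
  field
    z∈       : P z
    o∈       : P o
    neg∈     : ∀ {x} → P x → P (neg x)
    plus∈    : ∀ {x y} → P x → P y → P (plus x y)
    times∈   : ∀ {x y} → P x → P y → P (times x y)
    assoc    : ∀ {x y w} → P x → P y → P w → plus x (plus y w) ≡ plus (plus x y) w
    comm     : ∀ {x y} → P x → P y → plus x y ≡ plus y x
    idʳ      : ∀ {x} → P x → plus x z ≡ x
    absorb   : ∀ {x} → P x → plus x (neg z) ≡ neg z
    negneg   : ∀ {x} → P x → neg (neg x) ≡ x
    luk      : ∀ {x y} → P x → P y →
               plus (neg (plus (neg x) y)) y ≡ plus (neg (plus (neg y) x)) x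
    times-def : ∀ {x y} → P x → P y → times x y ≡ neg (plus (neg x) (neg y))
    one-def  : o ≡ neg z

record IsIMVHom {a b : Level} (J : IMVAlgebra a) (K : IMVAlgebra b)
       (θ : Carrier J → Carrier K) : Set (a ⊔ b) where
  field
    pres-𝟘 : θ (𝟘 J) ≡ 𝟘 K
    pres-𝟙 : θ (𝟙 J) ≡ 𝟙 K
    pres-ι : θ (ι J) ≡ ι K
    pres-¬ : ∀ x → θ ((¬_) J x) ≡ (¬_) K (θ x)
    pres-Δ : ∀ x → θ (Δ J x) ≡ Δ K (θ x)
    pres-∇ : ∀ x → θ (∇ J x) ≡ ∇ K (θ x)
    pres-⊕ : ∀ x y → θ (_⊕_ J x y) ≡ _⊕_ K (θ x) (θ y)
    pres-⊙ : ∀ x y → θ (_⊙_ J x y) ≡ _⊙_ K (θ x) (θ y)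

record IsCenterHom {a b : Level} (J : IMVAlgebra a) (K : IMVAlgebra b)
       (θ : Carrier J → Carrier K) : Set (a ⊔ b) where
  field
    maps-center : ∀ {x} → Center J x → Center K (θ x)
    pres-𝟘 : θ (𝟘 J) ≡ 𝟘 K
    pres-𝟙 : θ (𝟙 J) ≡ 𝟙 K
    pres-¬ : ∀ {x} → Center J x → θ ((¬_) J x) ≡ (¬_) K (θ x)
    pres-⊕ : ∀ {x y} → Center J x → Center J y → θ (_⊕_ J x y) ≡ _⊕_ K (θ x) (θ y)
    pres-⊙ : ∀ {x y} → Center J x → Center J y → θ (_⊙_ J x y) ≡ _⊙_ K (θ x) (θ y)

-- Every x decomposes as Δx ⊕ (ι ⊙ ∇x ⊙ ¬Δx).  On a central x the second
-- summand collapses to 𝟘 (because Δx ⊙ ¬∇x = 𝟘), so central elements are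
-- exactly the fixed points of Δ (equivalently of ∇), and Δ is idempotent with
-- image closed under ¬ and ⊕; on the center the Łukasiewicz axiom for Δ-images
-- therefore holds for the elements themselves, which gives the MV-axioms and
-- antisymmetry of the natural order.  Finally an interval of 𝓘(𝒞(J)) determines
-- its endpoints by antisymmetry, and the decomposition shows that x is
-- determined by the pair (Δx, ∇x).
module Submission where

open import Defs
open import Level using (Level)
open import Relation.Binary.PropositionalEquality
  using (_≡_; sym; trans; cong; cong₂; subst; module ≡-Reasoning)
open import Data.Product using (_×_; _,_; ∃; proj₁; proj₂)
open import Function.Bundles using (_⇔_; mk⇔; Equivalence)

module Properties {a : Level} (J : IMVAlgebra a) where
  open IMVAlgebra J
  open ≡-Reasoning

  ⊕-identityˡ : ∀ x → 𝟘 ⊕ x ≡ x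
  ⊕-identityˡ x = trans (⊕-comm 𝟘 x) (⊕-idʳ x)

  ⊕-zeroʳ : ∀ x → x ⊕ 𝟙 ≡ 𝟙
  ⊕-zeroʳ x = trans (cong (x ⊕_) 𝟙-def) (trans (⊕-absorb x) (sym 𝟙-def))

  ¬𝟙 : ¬ 𝟙 ≡ 𝟘
  ¬𝟙 = trans (cong ¬_ 𝟙-def) (¬¬ 𝟘)

  ¬𝟘 : ¬ 𝟘 ≡ 𝟙
  ¬𝟘 = sym 𝟙-def

  ¬-⊙ : ∀ x y → ¬ (x ⊙ y) ≡ ¬ x ⊕ ¬ y
  ¬-⊙ x y = trans (cong ¬_ (⊙-def x y)) (¬¬ (¬ x ⊕ ¬ y))

  ⊙-assoc : ∀ x y z → (x ⊙ y) ⊙ z ≡ x ⊙ (y ⊙ z)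
  ⊙-assoc x y z = begin
    (x ⊙ y) ⊙ z               ≡⟨ ⊙-def (x ⊙ y) z ⟩
    ¬ (¬ (x ⊙ y) ⊕ ¬ z)       ≡⟨ cong (λ t → ¬ (t ⊕ ¬ z)) (¬-⊙ x y) ⟩
    ¬ ((¬ x ⊕ ¬ y) ⊕ ¬ z)     ≡⟨ cong ¬_ (sym (⊕-assoc (¬ x) (¬ y) (¬ z))) ⟩
    ¬ (¬ x ⊕ (¬ y ⊕ ¬ z))     ≡⟨ cong (λ t → ¬ (¬ x ⊕ t)) (sym (¬-⊙ y z)) ⟩
    ¬ (¬ x ⊕ ¬ (y ⊙ z))       ≡⟨ sym (⊙-def x (y ⊙ z)) ⟩
    x ⊙ (y ⊙ z)               ∎

  ⊙-zeroʳ : ∀ x → x ⊙ 𝟘 ≡ 𝟘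
  ⊙-zeroʳ x = trans (⊙-def x 𝟘) (trans (cong ¬_ (⊕-absorb (¬ x))) (¬¬ 𝟘))

  ∇-¬ : ∀ x → ∇ (¬ x) ≡ ¬ Δ x
  ∇-¬ x = trans (∇-def (¬ x)) (cong (λ t → ¬ Δ t) (¬¬ x))

  ¬-∇ : ∀ x → ¬ ∇ x ≡ Δ (¬ x)
  ¬-∇ x = trans (cong ¬_ (∇-def x)) (¬¬ (Δ (¬ x)))

  ∇∇ : ∀ x → ∇ (∇ x) ≡ ∇ x
  ∇∇ x = begin
    ∇ (∇ x)          ≡⟨ ∇-def (∇ x) ⟩
    ¬ Δ (¬ ∇ x)      ≡⟨ cong (λ t → ¬ Δ t) (¬-∇ x) ⟩
    ¬ Δ (Δ (¬ x))    ≡⟨ cong ¬_ (ΔΔ (¬ x)) ⟩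
    ¬ Δ (¬ x)        ≡⟨ sym (∇-def x) ⟩
    ∇ x              ∎

  ∇Δ : ∀ x → ∇ (Δ x) ≡ Δ x
  ∇Δ x = begin
    ∇ (Δ x)         ≡⟨ ∇-def (Δ x) ⟩
    ¬ Δ (¬ Δ x)     ≡⟨ cong (λ t → ¬ Δ t) (sym (∇-¬ x)) ⟩
    ¬ Δ (∇ (¬ x))   ≡⟨ cong ¬_ (Δ∇ (¬ x)) ⟩
    ¬ ∇ (¬ x)       ≡⟨ cong ¬_ (∇-¬ x) ⟩
    ¬ ¬ Δ x         ≡⟨ ¬¬ (Δ x) ⟩
    Δ x             ∎

  Δ⊙¬Δ-central : ∀ {x} → Center x → Δ x ⊙ ¬ Δ x ≡ 𝟘
  Δ⊙¬Δ-central {x} c = trans (cong (λ t → Δ x ⊙ ¬ t) c) (Δ⊙¬∇ x)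

  central⇒Δ-fixed : ∀ {x} → Center x → x ≡ Δ x
  central⇒Δ-fixed {x} c = begin
    x                              ≡⟨ sym (decomp x) ⟩
    Δ x ⊕ (ι ⊙ ∇ x ⊙ ¬ Δ x)        ≡⟨ cong (λ t → Δ x ⊕ (ι ⊙ t ⊙ ¬ Δ x)) (sym c) ⟩
    Δ x ⊕ (ι ⊙ Δ x ⊙ ¬ Δ x)        ≡⟨ cong (Δ x ⊕_) (⊙-assoc ι (Δ x) (¬ Δ x)) ⟩
    Δ x ⊕ (ι ⊙ (Δ x ⊙ ¬ Δ x))      ≡⟨ cong (λ t → Δ x ⊕ (ι ⊙ t)) (Δ⊙¬Δ-central c) ⟩
    Δ x ⊕ (ι ⊙ 𝟘)                  ≡⟨ cong (Δ x ⊕_) (⊙-zeroʳ ι) ⟩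
    Δ x ⊕ 𝟘                        ≡⟨ ⊕-idʳ (Δ x) ⟩
    Δ x                            ∎

  central⇒∇-fixed : ∀ {x} → Center x → x ≡ ∇ x
  central⇒∇-fixed c = trans (central⇒Δ-fixed c) c

  Δ-central : ∀ x → Center (Δ x)
  Δ-central x = trans (ΔΔ x) (sym (∇Δ x))

  ∇-central : ∀ x → Center (∇ x)
  ∇-central x = trans (Δ∇ x) (sym (∇∇ x))

  Δ-image⇒central : ∀ {x y} → x ≡ Δ y → Center x
  Δ-image⇒central {y = y} e = subst Center (sym e) (Δ-central y)

  ∇-image⇒central : ∀ {x z} → x ≡ ∇ z → Center x
  ∇-image⇒central {z = z} e = subst Center (sym e) (∇-central z)

  central-characterisations : ∀ x →
      (Center x ⇔ (x ≡ ∇ x)) × (Center x ⇔ (x ≡ Δ x))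
    × (Center x ⇔ ∃ (λ y → x ≡ Δ y)) × (Center x ⇔ ∃ (λ z → x ≡ ∇ z))
  central-characterisations x =
      mk⇔ central⇒∇-fixed ∇-image⇒central
    , mk⇔ central⇒Δ-fixed Δ-image⇒central
    , mk⇔ (λ c → x , central⇒Δ-fixed c) (λ (_ , e) → Δ-image⇒central e)
    , mk⇔ (λ c → x , central⇒∇-fixed c) (λ (_ , e) → ∇-image⇒central e)

  ¬-central : ∀ {x} → Center x → Center (¬ x)
  ¬-central {x} c =
    ∇-image⇒central (trans (cong ¬_ (central⇒Δ-fixed c)) (sym (∇-¬ x)))

  ⊕-central : ∀ {x y} → Center x → Center y → Center (x ⊕ y)
  ⊕-central {x} {y} cx cy = Δ-image⇒central
    (trans (cong₂ _⊕_ (central⇒Δ-fixed cx) (central⇒Δ-fixed cy)) (sym (Δ-⊕ x y)))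

  ⊙-central : ∀ {x y} → Center x → Center y → Center (x ⊙ y)
  ⊙-central {x} {y} cx cy = Δ-image⇒central
    (trans (cong₂ _⊙_ (central⇒Δ-fixed cx) (central⇒Δ-fixed cy)) (sym (Δ-⊙ x y)))

  luk-central : ∀ {x y} → Center x → Center y →
                ¬ (¬ x ⊕ y) ⊕ y ≡ ¬ (¬ y ⊕ x) ⊕ x
  luk-central {x} {y} cx cy = begin
    ¬ (¬ x ⊕ y) ⊕ y           ≡⟨ cong₂ luk (central⇒Δ-fixed cx) (central⇒Δ-fixed cy) ⟩
    ¬ (¬ Δ x ⊕ Δ y) ⊕ Δ y     ≡⟨ Δ-luk x y ⟩
    ¬ (¬ Δ y ⊕ Δ x) ⊕ Δ x     ≡⟨ sym (cong₂ luk (central⇒Δ-fixed cy) (central⇒Δ-fixed cx)) ⟩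
    ¬ (¬ y ⊕ x) ⊕ x           ∎
    where
    luk : Carrier → Carrier → Carrier
    luk s t = ¬ (¬ s ⊕ t) ⊕ t

  center-isMVSubreduct : IsMVSubreduct Center 𝟘 𝟙 ¬_ _⊕_ _⊙_
  center-isMVSubreduct = record
    { z∈        = Δ-image⇒central (sym Δ𝟘)
    ; o∈        = Δ-image⇒central (sym Δ𝟙)
    ; neg∈      = ¬-central
    ; plus∈     = ⊕-central
    ; times∈    = ⊙-central
    ; assoc     = λ {x} {y} {w} _ _ _ → ⊕-assoc x y w
    ; comm      = λ {x} {y} _ _ → ⊕-comm x y
    ; idʳ       = λ {x} _ → ⊕-idʳ x
    ; absorb    = λ {x} _ → ⊕-absorb x
    ; negneg    = λ {x} _ → ¬¬ x
    ; luk       = luk-central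
    ; times-def = λ {x} {y} _ _ → ⊙-def x y
    ; one-def   = 𝟙-def
    }

  ≤C-refl : ∀ {x} → Center x → x ≤C x
  ≤C-refl {x} c = begin
    ¬ x ⊕ x                ≡⟨ cong (λ t → ¬ t ⊕ x) (sym (⊕-identityˡ x)) ⟩
    ¬ (𝟘 ⊕ x) ⊕ x          ≡⟨ cong (λ t → ¬ (t ⊕ x) ⊕ x) (sym ¬𝟙) ⟩
    ¬ (¬ 𝟙 ⊕ x) ⊕ x        ≡⟨ luk-central (Δ-image⇒central (sym Δ𝟙)) c ⟩
    ¬ (¬ x ⊕ 𝟙) ⊕ 𝟙        ≡⟨ ⊕-zeroʳ _ ⟩
    𝟙                      ∎

  ≤C-antisym : ∀ {x y} → Center x → Center y → x ≤C y → y ≤C x → x ≡ y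
  ≤C-antisym {x} {y} cx cy x≤y y≤x = begin
    x                    ≡⟨ sym (⊕-identityˡ x) ⟩
    𝟘 ⊕ x                ≡⟨ cong (_⊕ x) (sym ¬𝟙) ⟩
    ¬ 𝟙 ⊕ x              ≡⟨ cong (λ t → ¬ t ⊕ x) (sym y≤x) ⟩
    ¬ (¬ y ⊕ x) ⊕ x      ≡⟨ luk-central cy cx ⟩
    ¬ (¬ x ⊕ y) ⊕ y      ≡⟨ cong (λ t → ¬ t ⊕ y) x≤y ⟩
    ¬ 𝟙 ⊕ y              ≡⟨ cong (_⊕ y) ¬𝟙 ⟩
    𝟘 ⊕ y                ≡⟨ ⊕-identityˡ y ⟩
    y                    ∎

  Δ≤C∇ : ∀ x → Δ x ≤C ∇ x
  Δ≤C∇ x = begin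
    ¬ Δ x ⊕ ∇ x          ≡⟨ cong (¬ Δ x ⊕_) (sym (¬¬ (∇ x))) ⟩
    ¬ Δ x ⊕ ¬ ¬ ∇ x      ≡⟨ sym (¬-⊙ (Δ x) (¬ ∇ x)) ⟩
    ¬ (Δ x ⊙ ¬ ∇ x)      ≡⟨ cong ¬_ (Δ⊙¬∇ x) ⟩
    ¬ 𝟘                  ≡⟨ ¬𝟘 ⟩
    𝟙                    ∎

  SameInterval⇒same-endpoints : ∀ {α β α' β'} →
    Center α → Center β → α ≤C β → Center α' → Center β' → α' ≤C β' →
    SameInterval α β α' β' → α ≡ α' × β ≡ β'
  SameInterval⇒same-endpoints {α} {β} {α'} {β'} cα cβ α≤β cα' cβ' α'≤β' S =
      ≤C-antisym cα cα' (proj₁ (proj₂ α'∈)) (proj₁ (proj₂ α∈'))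
    , ≤C-antisym cβ cβ' (proj₂ (proj₂ β∈')) (proj₂ (proj₂ β'∈))
    where
    α∈' : InInterval α' β' α
    α∈' = Equivalence.to   (S α)  (cα  , ≤C-refl cα  , α≤β)
    α'∈ : InInterval α β α'
    α'∈ = Equivalence.from (S α') (cα' , ≤C-refl cα' , α'≤β')
    β∈' : InInterval α' β' β
    β∈' = Equivalence.to   (S β)  (cβ  , α≤β         , ≤C-refl cβ)
    β'∈ : InInterval α β β'
    β'∈ = Equivalence.from (S β') (cβ' , α'≤β'       , ≤C-refl cβ')

  determined-by-Δ∇ : ∀ {x y} → Δ x ≡ Δ y → ∇ x ≡ ∇ y → x ≡ y
  determined-by-Δ∇ {x} {y} eΔ e∇ = begin
    x                          ≡⟨ sym (decomp x) ⟩
    Δ x ⊕ (ι ⊙ ∇ x ⊙ ¬ Δ x)    ≡⟨ cong₂ (λ s t → s ⊕ (ι ⊙ t ⊙ ¬ s)) eΔ e∇ ⟩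
    Δ y ⊕ (ι ⊙ ∇ y ⊙ ¬ Δ y)    ≡⟨ decomp y ⟩
    y                          ∎

  Δ∇-interval-injective : ∀ x y → SameInterval (Δ x) (∇ x) (Δ y) (∇ y) → x ≡ y
  Δ∇-interval-injective x y S =
    let eΔ , e∇ = SameInterval⇒same-endpoints
                    (Δ-central x) (∇-central x) (Δ≤C∇ x)
                    (Δ-central y) (∇-central y) (Δ≤C∇ y) S
    in determined-by-Δ∇ eΔ e∇

IsIMVHom⇒IsCenterHom : ∀ {a b} {J : IMVAlgebra a} {K : IMVAlgebra b}
  {θ : IMVAlgebra.Carrier J → IMVAlgebra.Carrier K} → IsIMVHom J K θ → IsCenterHom J K θ
IsIMVHom⇒IsCenterHom {θ = θ} h = record
  { maps-center = λ {x} c → trans (sym (pres-Δ x)) (trans (cong θ c) (pres-∇ x))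
  ; pres-𝟘      = pres-𝟘
  ; pres-𝟙      = pres-𝟙
  ; pres-¬      = λ {x} _ → pres-¬ x
  ; pres-⊕      = λ {x} {y} _ _ → pres-⊕ x y
  ; pres-⊙      = λ {x} {y} _ _ → pres-⊙ x y
  }
  where open IsIMVHom h

open IMVAlgebra

proposition3p3 : ∀ {a b} (J : IMVAlgebra a) →
    (∀ x → ((Δ J x ≡ ∇ J x) ⇔ (x ≡ ∇ J x))
         × ((Δ J x ≡ ∇ J x) ⇔ (x ≡ Δ J x))
         × ((Δ J x ≡ ∇ J x) ⇔ ∃ (λ y → x ≡ Δ J y))
         × ((Δ J x ≡ ∇ J x) ⇔ ∃ (λ z → x ≡ ∇ J z)))
  × IsMVSubreduct (Center J) (𝟘 J) (𝟙 J) (¬_ J) (_⊕_ J) (_⊙_ J)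
  × (∀ (K : IMVAlgebra b) (θ : Carrier J → Carrier K) →
       IsIMVHom J K θ → IsCenterHom J K θ)
  × (∀ x → Center J (Δ J x) × Center J (∇ J x) × _≤C_ J (Δ J x) (∇ J x))
  × (∀ x y → SameInterval J (Δ J x) (∇ J x) (Δ J y) (∇ J y) → x ≡ y)
proposition3p3 J =
    central-characterisations
  , center-isMVSubreduct
  , (λ _ _ → IsIMVHom⇒IsCenterHom)
  , (λ x → Δ-central x , ∇-central x , Δ≤C∇ x)
  , Δ∇-interval-injective
  where open Properties J
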